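{- Let $\ell\ge 2$ be an integer and, regarding $X$ and $d$ as indeterminates, set $$F(X,d)=\prod_{\substack{1\le j\le \ell\\ j\ \text{odd}}}(X+jd)^{\binom{\ell}{j}}-\prod_{\substack{0\le j\le \ell\\ j\ \text{even}}}(X+jd)^{\binom{\ell}{j}}.$$ Then $F(X,d)=d^{\ell}\,G(X,d)$, where $G(X,d)$ is a homogeneous polynomial (binary form) in $X$ and $d$ with integer coefficients, of degree $2^{\ell-1}-\ell$, satisfying $G(1,0)=(\ell-1)!$. In particular, for every integer $d\ge 1$, $F(X,d)=d^\ell G(X,d)$ as polynomials in $X$. -}

module Defs where

open import Data.Nat as ℕ using (ℕ; zero; suc)
open import Data.Nat.Combinatorics using (_C_)
open import Data.Nat.DivMod using (_%_)
open import Data.Integer as ℤ using (ℤ; +_; _+_; _*_; _^_)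
open import Data.List using (List; upTo; foldr; map)
open import Data.Vec using (Vec; lookup)
open import Data.Fin using (Fin; toℕ)
open import Data.List using (allFin)

prodℤ : List ℤ → ℤ
prodℤ = foldr _*_ (+ 1)

sumℤ : List ℤ → ℤ
sumℤ = foldr _+_ (+ 0)

factor : ℕ → ℕ → ℤ → ℤ → ℤ
factor ℓ j x d = (x + (+ j) * d) ^ (ℓ C j)

oddProd : ℕ → ℤ → ℤ → ℤ
oddProd ℓ x d = prodℤ (map (λ j → if1 (j % 2) j) (upTo (suc ℓ)))
  where
  if1 : ℕ → ℕ → ℤ
  if1 1 j = factor ℓ j x d
  if1 _ j = + 1

evenProd : ℕ → ℤ → ℤ → ℤ
evenProd ℓ x d = prodℤ (map (λ j → if0 (j % 2) j) (upTo (suc ℓ)))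
  where
  if0 : ℕ → ℕ → ℤ
  if0 0 j = factor ℓ j x d
  if0 _ j = + 1

F : ℕ → ℤ → ℤ → ℤ
F ℓ x d = oddProd ℓ x d ℤ.- evenProd ℓ x d

-- binary form of degree m with integer coefficients c₀,…,c_m:
--   G(X,d) = Σ_{i=0}^{m} c_i X^(m-i) d^i   (homogeneous of degree m)
evalForm : (m : ℕ) → Vec ℤ (suc m) → ℤ → ℤ → ℤ
evalForm m c x d =
  sumℤ (map (λ (i : Fin (suc m)) → lookup c i * (x ^ (m ℕ.∸ toℕ i)) * (d ^ toℕ i))
            (allFin (suc m)))

{-# OPTIONS --safe #-}
-- Write A_ℓ and B_ℓ for the odd and even products, so that F = A_ℓ − B_ℓ. Pascal's rule
-- (ℓ+1 choose j+1) = (ℓ choose j) + (ℓ choose j+1) gives A_{ℓ+1}(X) = A_ℓ(X)·B_ℓ(X+d) and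
-- B_{ℓ+1}(X) = B_ℓ(X)·A_ℓ(X+d), so A_ℓ and B_ℓ are binary forms of degree 2^(ℓ−1) with value 1 at
-- (X,d) = (1,0). If A − B = d^ℓ G, then substituting B = A − d^ℓ G gives
--   A_{ℓ+1} − B_{ℓ+1} = A(X)·B(X+d) − B(X)·A(X+d) = d^(ℓ+1) (A₁ G − A G₁),
-- where A(X+d) = A + d A₁ and G(X+d) = G + d G₁. At (1,0) the difference quotients A₁ and G₁ are
-- X-derivatives, so the new quotient takes the value (deg A − deg G)·G(1,0) = ℓ·(ℓ−1)! = ℓ! there.
module Submission where

open import Defs
open import Data.Bool using (Bool; true; false; not; if_then_else_)
open import Data.Fin as Fin using (Fin; toℕ)
open import Data.Integer using (ℤ; +_; -_; _+_; _-_; _*_; _^_; 0ℤ; 1ℤ)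
import Data.Integer.Properties as ℤ
open import Data.Integer.Tactic.RingSolver using (solve-∀)
open import Data.List using (map; applyUpTo; tabulate)
import Data.List.Properties as List
open import Data.Nat as ℕ using (ℕ; zero; suc; _≤_; _∸_; _!; _≡ᵇ_)
import Data.Nat.Properties as ℕ
import Data.Nat.Tactic.RingSolver as ℕ
open import Data.Nat.Combinatorics using (_C_; nCk+nC[k+1]≡[n+1]C[k+1]; k>n⇒nCk≡0)
open import Data.Nat.DivMod using (_%_)
open import Data.Product using (Σ; Σ-syntax; _×_; _,_; proj₁; proj₂)
open import Data.Vec using (Vec; []; _∷_; _∷ʳ_; lookup; zipWith)
import Data.Vec as Vec
open import Function using (id)
open import Relation.Binary.PropositionalEquality

Fn₂ : Set
Fn₂ = ℤ → ℤ → ℤ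

horner : ∀ m → Vec ℤ (suc m) → Fn₂
horner zero    (c ∷ [])  x d = c
horner (suc m) (c ∷ cs) x d = c * x ^ suc m + d * horner m cs x d

IsForm : ℕ → Fn₂ → Set
IsForm m f = Σ[ c ∈ Vec ℤ (suc m) ] ∀ x d → f x d ≡ horner m c x d

isForm-resp : ∀ {m} {f g : Fn₂} → (∀ x d → g x d ≡ f x d) → IsForm m f → IsForm m g
isForm-resp g≡f (c , f≡) = c , λ x d → trans (g≡f x d) (f≡ x d)

isForm-cast : ∀ {m n f} → m ≡ n → IsForm m f → IsForm n f
isForm-cast refl F = F

horner-1-0 : ∀ m c → horner m c 1ℤ 0ℤ ≡ Vec.head c
horner-1-0 zero    (c ∷ [])  = refl
horner-1-0 (suc m) (c ∷ cs) = begin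
  c * 1ℤ ^ suc m + 0ℤ * horner m cs 1ℤ 0ℤ ≡⟨ cong (λ p → c * p + 0ℤ * horner m cs 1ℤ 0ℤ) (ℤ.^-zeroˡ (suc m)) ⟩
  c * 1ℤ + 0ℤ * horner m cs 1ℤ 0ℤ         ≡⟨ simplify c (horner m cs 1ℤ 0ℤ) ⟩
  c                                       ∎
  where
  open ≡-Reasoning
  simplify : ∀ c e → c * 1ℤ + 0ℤ * e ≡ c
  simplify = solve-∀

sumℤ-tabulate-*ˡ : ∀ n k (f : Fin n → ℤ) → sumℤ (tabulate (λ i → k * f i)) ≡ k * sumℤ (tabulate f)
sumℤ-tabulate-*ˡ zero    k f = sym (ℤ.*-zeroʳ k)
sumℤ-tabulate-*ˡ (suc n) k f = begin
  k * f Fin.zero + sumℤ (tabulate (λ i → k * f (Fin.suc i))) ≡⟨ cong (λ s → k * f Fin.zero + s) (sumℤ-tabulate-*ˡ n k (λ i → f (Fin.suc i))) ⟩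
  k * f Fin.zero + k * sumℤ (tabulate (λ i → f (Fin.suc i))) ≡⟨ sym (ℤ.*-distribˡ-+ k _ _) ⟩
  k * sumℤ (tabulate f)                                      ∎
  where open ≡-Reasoning

horner≡sum : ∀ m c x d → sumℤ (tabulate (λ i → lookup c i * x ^ (m ∸ toℕ i) * d ^ toℕ i)) ≡ horner m c x d
horner≡sum zero    (c ∷ [])  x d = simplify c
  where
  simplify : ∀ c → c * 1ℤ * 1ℤ + 0ℤ ≡ c
  simplify = solve-∀
horner≡sum (suc m) (c ∷ cs) x d = begin
  c * x ^ suc m * 1ℤ + sumℤ (tabulate (λ i → term i * (d * d ^ toℕ i)))
    ≡⟨ cong (λ s → c * x ^ suc m * 1ℤ + sumℤ s) (List.tabulate-cong (λ i → swap (term i) d (d ^ toℕ i))) ⟩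
  c * x ^ suc m * 1ℤ + sumℤ (tabulate (λ i → d * (term i * d ^ toℕ i)))
    ≡⟨ cong (λ s → c * x ^ suc m * 1ℤ + s) (sumℤ-tabulate-*ˡ (suc m) d (λ i → term i * d ^ toℕ i)) ⟩
  c * x ^ suc m * 1ℤ + d * sumℤ (tabulate (λ i → term i * d ^ toℕ i))
    ≡⟨ cong (λ s → c * x ^ suc m * 1ℤ + d * s) (horner≡sum m cs x d) ⟩
  c * x ^ suc m * 1ℤ + d * horner m cs x d
    ≡⟨ cong (_+ d * horner m cs x d) (ℤ.*-identityʳ (c * x ^ suc m)) ⟩
  horner (suc m) (c ∷ cs) x d ∎
  where
  open ≡-Reasoning
  term : Fin (suc m) → ℤ
  term i = lookup cs i * x ^ (m ∸ toℕ i)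
  swap : ∀ a d e → a * (d * e) ≡ d * (a * e)
  swap = solve-∀

evalForm≡horner : ∀ m c x d → evalForm m c x d ≡ horner m c x d
evalForm≡horner m c x d =
  trans (cong sumℤ (List.map-tabulate id (λ i → lookup c i * x ^ (m ∸ toℕ i) * d ^ toℕ i)))
        (horner≡sum m c x d)

isForm⇒evalForm : ∀ {m f} → IsForm m f → Σ[ c ∈ Vec ℤ (suc m) ] ∀ x d → f x d ≡ evalForm m c x d
isForm⇒evalForm {m} (c , f≡) = c , λ x d → trans (f≡ x d) (sym (evalForm≡horner m c x d))

isForm-const : ∀ k → IsForm 0 (λ _ _ → k)
isForm-const k = (k ∷ []) , λ _ _ → refl

isForm0-shift : ∀ {f} → IsForm 0 f → ∀ x d → f (x + d) d ≡ f x d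
isForm0-shift ((c ∷ []) , f≡) x d = trans (f≡ (x + d) d) (sym (f≡ x d))

horner-∷ʳ0 : ∀ m c x d → horner (suc m) (c ∷ʳ 0ℤ) x d ≡ x * horner m c x d
horner-∷ʳ0 zero    (c ∷ [])  x d = simplify c x d
  where
  simplify : ∀ c x d → c * (x * 1ℤ) + d * 0ℤ ≡ x * c
  simplify = solve-∀
horner-∷ʳ0 (suc m) (c ∷ cs) x d =
  trans (cong (λ e → c * x ^ suc (suc m) + d * e) (horner-∷ʳ0 m cs x d))
        (factor-x c x (x ^ suc m) d (horner m cs x d))
  where
  factor-x : ∀ c x p d e → c * (x * p) + d * (x * e) ≡ x * (c * p + d * e)
  factor-x = solve-∀

isForm-x* : ∀ {m f} → IsForm m f → IsForm (suc m) (λ x d → x * f x d)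
isForm-x* {m} (c , f≡) = c ∷ʳ 0ℤ , λ x d → trans (cong (x *_) (f≡ x d)) (sym (horner-∷ʳ0 m c x d))

isForm-d* : ∀ {m f} → IsForm m f → IsForm (suc m) (λ x d → d * f x d)
isForm-d* {m} (c , f≡) = 0ℤ ∷ c , λ x d → trans (cong (d *_) (f≡ x d)) (sym (ℤ.+-identityˡ _))

horner-+ : ∀ m c c′ x d → horner m (zipWith _+_ c c′) x d ≡ horner m c x d + horner m c′ x d
horner-+ zero    (a ∷ [])  (b ∷ [])  x d = refl
horner-+ (suc m) (a ∷ as) (b ∷ bs) x d =
  trans (cong (λ e → (a + b) * x ^ suc m + d * e) (horner-+ m as bs x d))
        (distribute a b (x ^ suc m) d (horner m as x d) (horner m bs x d))
  where
  distribute : ∀ a b p d e f → (a + b) * p + d * (e + f) ≡ (a * p + d * e) + (b * p + d * f)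
  distribute = solve-∀

isForm-+ : ∀ {m f g} → IsForm m f → IsForm m g → IsForm m (λ x d → f x d + g x d)
isForm-+ {m} (c , f≡) (c′ , g≡) =
  zipWith _+_ c c′ , λ x d → trans (cong₂ _+_ (f≡ x d) (g≡ x d)) (sym (horner-+ m c c′ x d))

horner-scale : ∀ m k c x d → horner m (Vec.map (k *_) c) x d ≡ k * horner m c x d
horner-scale zero    k (a ∷ [])  x d = refl
horner-scale (suc m) k (a ∷ as) x d =
  trans (cong (λ e → k * a * x ^ suc m + d * e) (horner-scale m k as x d))
        (distribute k a (x ^ suc m) d (horner m as x d))
  where
  distribute : ∀ k a p d e → k * a * p + d * (k * e) ≡ k * (a * p + d * e)
  distribute = solve-∀

isForm-scale : ∀ {m f} k → IsForm m f → IsForm m (λ x d → k * f x d)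
isForm-scale {m} k (c , f≡) =
  Vec.map (k *_) c , λ x d → trans (cong (k *_) (f≡ x d)) (sym (horner-scale m k c x d))

isForm-- : ∀ {m f g} → IsForm m f → IsForm m g → IsForm m (λ x d → f x d - g x d)
isForm-- {f = f} {g} F G =
  isForm-resp (λ x d → sub-as-add (f x d) (g x d)) (isForm-+ F (isForm-scale (- 1ℤ) G))
  where
  sub-as-add : ∀ a b → a - b ≡ a + - 1ℤ * b
  sub-as-add = solve-∀

isForm-x^* : ∀ {n g} k → IsForm n g → IsForm (k ℕ.+ n) (λ x d → x ^ k * g x d)
isForm-x^* {g = g} zero    G = isForm-resp (λ x d → ℤ.*-identityˡ (g x d)) G
isForm-x^* {g = g} (suc k) G = isForm-resp (λ x d → ℤ.*-assoc x (x ^ k) (g x d)) (isForm-x* (isForm-x^* k G))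

isForm-horner* : ∀ m c {n g} → IsForm n g → IsForm (m ℕ.+ n) (λ x d → horner m c x d * g x d)
isForm-horner* zero    (c ∷ [])  G = isForm-scale c G
isForm-horner* (suc m) (c ∷ cs) {g = g} G =
  isForm-resp (λ x d → distribute c (x ^ suc m) d (horner m cs x d) (g x d))
              (isForm-+ (isForm-scale c (isForm-x^* (suc m) G)) (isForm-d* (isForm-horner* m cs G)))
  where
  distribute : ∀ c p d e g → (c * p + d * e) * g ≡ c * (p * g) + d * (e * g)
  distribute = solve-∀

isForm-* : ∀ {m n f g} → IsForm m f → IsForm n g → IsForm (m ℕ.+ n) (λ x d → f x d * g x d)
isForm-* {m} {g = g} (c , f≡) G = isForm-resp (λ x d → cong (_* g x d) (f≡ x d)) (isForm-horner* m c G)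

isForm-x^ : ∀ k → IsForm k (λ x d → x ^ k)
isForm-x^ zero    = isForm-const 1ℤ
isForm-x^ (suc k) = isForm-x* (isForm-x^ k)

isForm-x+d : IsForm 1 (λ x d → x + d)
isForm-x+d = (1ℤ ∷ 1ℤ ∷ []) , expand
  where
  expand : ∀ x d → x + d ≡ 1ℤ * (x * 1ℤ) + d * 1ℤ
  expand = solve-∀

isForm-[x+d]^ : ∀ k → IsForm k (λ x d → (x + d) ^ k)
isForm-[x+d]^ zero    = isForm-const 1ℤ
isForm-[x+d]^ (suc k) = isForm-* isForm-x+d (isForm-[x+d]^ k)

isForm-horner-shift : ∀ m c → IsForm m (λ x d → horner m c (x + d) d)
isForm-horner-shift zero    (c ∷ [])  = isForm-const c
isForm-horner-shift (suc m) (c ∷ cs) =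
  isForm-+ (isForm-scale c (isForm-[x+d]^ (suc m))) (isForm-d* (isForm-horner-shift m cs))

isForm-shift : ∀ {m f} → IsForm m f → IsForm m (λ x d → f (x + d) d)
isForm-shift {m} (c , f≡) = isForm-resp (λ x d → f≡ (x + d) d) (isForm-horner-shift m c)

powDiff : ℕ → Fn₂
powDiff zero    x d = 1ℤ
powDiff (suc k) x d = x ^ suc k + (x + d) * powDiff k x d

[x+d]^suc≡ : ∀ k x d → (x + d) ^ suc k ≡ x ^ suc k + d * powDiff k x d
[x+d]^suc≡ zero    x d = expand x d
  where
  expand : ∀ x d → (x + d) * 1ℤ ≡ x * 1ℤ + d * 1ℤ
  expand = solve-∀
[x+d]^suc≡ (suc k) x d =
  trans (cong ((x + d) *_) ([x+d]^suc≡ k x d)) (expand x d (x ^ suc k) (powDiff k x d))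
  where
  expand : ∀ x d p q → (x + d) * (p + d * q) ≡ x * p + d * (p + (x + d) * q)
  expand = solve-∀

isForm-powDiff : ∀ k → IsForm k (powDiff k)
isForm-powDiff zero    = isForm-const 1ℤ
isForm-powDiff (suc k) = isForm-+ (isForm-x^ (suc k)) (isForm-* isForm-x+d (isForm-powDiff k))

powDiff-1-0 : ∀ k → powDiff k 1ℤ 0ℤ ≡ + suc k
powDiff-1-0 zero    = refl
powDiff-1-0 (suc k) = begin
  1ℤ ^ suc k + (1ℤ + 0ℤ) * powDiff k 1ℤ 0ℤ ≡⟨ cong₂ (λ p q → p + (1ℤ + 0ℤ) * q) (ℤ.^-zeroˡ (suc k)) (powDiff-1-0 k) ⟩
  1ℤ + 1ℤ * + suc k                       ≡⟨ cong (_+_ 1ℤ) (ℤ.*-identityˡ (+ suc k)) ⟩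
  1ℤ + + suc k                            ≡⟨ sym (ℤ.pos-+ 1 (suc k)) ⟩
  + suc (suc k)                           ∎
  where open ≡-Reasoning

-- Δ(X,0) is the X-derivative of f, whence Δ-1-0.
record Difference (m : ℕ) (f : Fn₂) : Set where
  field
    Δ      : Fn₂
    Δ-form : IsForm m Δ
    shift  : ∀ x d → f (x + d) d ≡ f x d + d * Δ x d
    Δ-1-0  : Δ 1ℤ 0ℤ ≡ + suc m * f 1ℤ 0ℤ

Difference-resp : ∀ {m f g} → (∀ x d → f x d ≡ g x d) → Difference m g → Difference m f
Difference-resp {m} {f} {g} f≡g D = record
  { Δ      = Δ
  ; Δ-form = Δ-form
  ; shift  = λ x d → trans (f≡g (x + d) d) (trans (shift x d) (cong (_+ d * Δ x d) (sym (f≡g x d))))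
  ; Δ-1-0  = trans Δ-1-0 (cong (+ suc m *_) (sym (f≡g 1ℤ 0ℤ)))
  }
  where open Difference D

horner-difference : ∀ m c → Difference m (horner (suc m) c)
horner-difference zero (c ∷ c₁ ∷ []) = record
  { Δ      = λ _ _ → c
  ; Δ-form = isForm-const c
  ; shift  = λ x d → expand c c₁ x d
  ; Δ-1-0  = trans (sym (ℤ.*-identityˡ c)) (cong (1ℤ *_) (sym (horner-1-0 1 (c ∷ c₁ ∷ []))))
  }
  where
  expand : ∀ c c₁ x d → c * ((x + d) * 1ℤ) + d * c₁ ≡ (c * (x * 1ℤ) + d * c₁) + d * c
  expand = solve-∀
horner-difference (suc m) (c ∷ cs) = record
  { Δ      = λ x d → c * powDiff (suc m) x d + d * Δ x d
  ; Δ-form = isForm-+ (isForm-scale c (isForm-powDiff (suc m))) (isForm-d* Δ-form)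
  ; shift  = λ x d → trans (cong₂ (λ p e → c * p + d * e) ([x+d]^suc≡ (suc m) x d) (shift x d))
                           (regroup c (x ^ suc (suc m)) d (powDiff (suc m) x d) (horner (suc m) cs x d) (Δ x d))
  ; Δ-1-0  = begin
      c * powDiff (suc m) 1ℤ 0ℤ + 0ℤ * Δ 1ℤ 0ℤ ≡⟨ cong (λ p → c * p + 0ℤ * Δ 1ℤ 0ℤ) (powDiff-1-0 (suc m)) ⟩
      c * + suc (suc m) + 0ℤ * Δ 1ℤ 0ℤ         ≡⟨ simplify c (+ suc (suc m)) (Δ 1ℤ 0ℤ) ⟩
      + suc (suc m) * c                         ≡⟨ cong (+ suc (suc m) *_) (sym (horner-1-0 (suc (suc m)) (c ∷ cs))) ⟩
      + suc (suc m) * horner (suc (suc m)) (c ∷ cs) 1ℤ 0ℤ ∎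
  }
  where
  open Difference (horner-difference m cs)
  open ≡-Reasoning
  regroup : ∀ c p d q e g → c * (p + d * q) + d * (e + d * g) ≡ (c * p + d * e) + d * (c * q + d * g)
  regroup = solve-∀
  simplify : ∀ c s g → c * s + 0ℤ * g ≡ s * c
  simplify = solve-∀

difference : ∀ {m f} → IsForm (suc m) f → Difference m f
difference {m} (c , f≡) = Difference-resp f≡ (horner-difference m c)

cross-identity : ∀ k {A B G A₁ G₁ : Fn₂} →
  (∀ x d → A x d - B x d ≡ d ^ suc k * G x d) →
  (∀ x d → A (x + d) d ≡ A x d + d * A₁ x d) →
  (∀ x d → G (x + d) d ≡ G x d + d * G₁ x d) →
  ∀ x d → A x d * B (x + d) d - B x d * A (x + d) d ≡ d ^ suc (suc k) * (A₁ x d * G x d - A x d * G₁ x d)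
cross-identity k {A} {B} {G} {A₁} {G₁} A-B A-shift G-shift x d = begin
  a * B (x + d) d - B x d * a′
    ≡⟨ cong₂ (λ u v → a * u - v * a′) (solve-for a′ _ (A-B (x + d) d)) (solve-for a _ (A-B x d)) ⟩
  a * (a′ - D * G (x + d) d) - (a - D * g) * a′
    ≡⟨ cong₂ (λ u v → a * (u - D * v) - (a - D * g) * u) (A-shift x d) (G-shift x d) ⟩
  a * ((a + d * a₁) - D * (g + d * g₁)) - (a - D * g) * (a + d * a₁)
    ≡⟨ expand a g a₁ g₁ d D ⟩
  d * D * (a₁ * g - a * g₁) ∎
  where
  open ≡-Reasoning
  a a′ a₁ g g₁ D : ℤ
  a = A x d
  a′ = A (x + d) d
  a₁ = A₁ x d
  g = G x d
  g₁ = G₁ x d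
  D = d ^ suc k
  double-sub : ∀ a b → b ≡ a - (a - b)
  double-sub = solve-∀
  solve-for : ∀ a b {c} → a - b ≡ c → b ≡ a - c
  solve-for a b refl = double-sub a b
  expand : ∀ a g a₁ g₁ d D →
    a * ((a + d * a₁) - D * (g + d * g₁)) - (a - D * g) * (a + d * a₁) ≡ d * D * (a₁ * g - a * g₁)
  expand = solve-∀

record FormQuotient (e m : ℕ) (P : Fn₂) (g : ℤ) : Set where
  field
    G      : Fn₂
    G-form : IsForm m G
    split  : ∀ x d → P x d ≡ d ^ e * G x d
    G-1-0  : G 1ℤ 0ℤ ≡ g

FormQuotient-resp : ∀ {e m P P′ g g′} → (∀ x d → P′ x d ≡ P x d) → g ≡ g′ →
  FormQuotient e m P g → FormQuotient e m P′ g′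
FormQuotient-resp P′≡P refl Q = record
  { G      = G
  ; G-form = G-form
  ; split  = λ x d → trans (P′≡P x d) (split x d)
  ; G-1-0  = G-1-0
  }
  where open FormQuotient Q

cross-difference : ∀ k m {A B : Fn₂} {g} → IsForm (m ℕ.+ suc k) A →
  FormQuotient (suc k) m (λ x d → A x d - B x d) g →
  FormQuotient (suc (suc k)) (m ℕ.+ k ℕ.+ m) (λ x d → A x d * B (x + d) d - B x d * A (x + d) d)
               (+ suc k * (A 1ℤ 0ℤ * g))
cross-difference k zero {A} {B} {g} A-form Q = record
  { G      = λ x d → Δ x d * G x d
  ; G-form = isForm-* Δ-form G-form
  ; split  = λ x d → trans (cross-identity k {A} {B} {G} {Δ} {λ _ _ → 0ℤ} split shift G-shift x d)
                           (drop-zero (d ^ suc (suc k)) (A x d) (Δ x d * G x d))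
  ; G-1-0  = trans (cong₂ _*_ Δ-1-0 G-1-0) (ℤ.*-assoc (+ suc k) (A 1ℤ 0ℤ) g)
  }
  where
  open FormQuotient Q
  open Difference (difference A-form)
  add-zero : ∀ g d → g ≡ g + d * 0ℤ
  add-zero = solve-∀
  G-shift : ∀ x d → G (x + d) d ≡ G x d + d * 0ℤ
  G-shift x d = trans (isForm0-shift G-form x d) (add-zero (G x d) d)
  drop-zero : ∀ p a e → p * (e - a * 0ℤ) ≡ p * e
  drop-zero = solve-∀
cross-difference k (suc m) {A} {B} {g} A-form Q = record
  { G      = λ x d → ΔA.Δ x d * G x d - A x d * ΔG.Δ x d
  ; G-form = isForm-- (isForm-cast (cong (ℕ._+ suc m) (ℕ.+-suc m k)) (isForm-* ΔA.Δ-form G-form))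
                      (isForm-cast (degree m k) (isForm-* A-form ΔG.Δ-form))
  ; split  = cross-identity k {A} {B} {G} {ΔA.Δ} {ΔG.Δ} split ΔA.shift ΔG.shift
  ; G-1-0  = begin
      ΔA.Δ 1ℤ 0ℤ * G 1ℤ 0ℤ - a * ΔG.Δ 1ℤ 0ℤ
        ≡⟨ cong₂ (λ u v → u * G 1ℤ 0ℤ - a * v) ΔA.Δ-1-0 ΔG.Δ-1-0 ⟩
      + (suc m ℕ.+ suc k) * a * G 1ℤ 0ℤ - a * (+ suc m * G 1ℤ 0ℤ)
        ≡⟨ cong (λ n → n * a * G 1ℤ 0ℤ - a * (+ suc m * G 1ℤ 0ℤ)) (ℤ.pos-+ (suc m) (suc k)) ⟩
      (+ suc m + + suc k) * a * G 1ℤ 0ℤ - a * (+ suc m * G 1ℤ 0ℤ)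
        ≡⟨ cancel (+ suc m) (+ suc k) a (G 1ℤ 0ℤ) ⟩
      + suc k * (a * G 1ℤ 0ℤ)
        ≡⟨ cong (λ h → + suc k * (a * h)) G-1-0 ⟩
      + suc k * (a * g) ∎
  }
  where
  open FormQuotient Q
  module ΔA = Difference (difference A-form)
  module ΔG = Difference (difference G-form)
  open ≡-Reasoning
  a : ℤ
  a = A 1ℤ 0ℤ
  degree : ∀ m k → suc m ℕ.+ suc k ℕ.+ m ≡ suc m ℕ.+ k ℕ.+ suc m
  degree = ℕ.solve-∀
  cancel : ∀ p q a g → (p + q) * a * g - a * (p * g) ≡ q * (a * g)
  cancel = solve-∀

∏ : ℕ → (ℕ → ℤ) → ℤ
∏ zero    f = 1ℤ
∏ (suc n) f = f 0 * ∏ n (λ j → f (suc j))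

prodℤ-map-applyUpTo : ∀ n (f : ℕ → ℤ) (g : ℕ → ℕ) → prodℤ (map f (applyUpTo g n)) ≡ ∏ n (λ j → f (g j))
prodℤ-map-applyUpTo zero    f g = refl
prodℤ-map-applyUpTo (suc n) f g = cong (f (g 0) *_) (prodℤ-map-applyUpTo n f (λ j → g (suc j)))

∏-cong : ∀ n {f g : ℕ → ℤ} → (∀ j → f j ≡ g j) → ∏ n f ≡ ∏ n g
∏-cong zero    f≡g = refl
∏-cong (suc n) f≡g = cong₂ _*_ (f≡g 0) (∏-cong n (λ j → f≡g (suc j)))

∏-unit : ∀ n {f : ℕ → ℤ} → (∀ j → f j ≡ 1ℤ) → ∏ n f ≡ 1ℤ
∏-unit zero    f≡1 = refl
∏-unit (suc n) f≡1 = cong₂ _*_ (f≡1 0) (∏-unit n (λ j → f≡1 (suc j)))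

∏-* : ∀ n (f g : ℕ → ℤ) → ∏ n (λ j → f j * g j) ≡ ∏ n f * ∏ n g
∏-* zero    f g = refl
∏-* (suc n) f g =
  trans (cong (f 0 * g 0 *_) (∏-* n (λ j → f (suc j)) (λ j → g (suc j))))
        (interchange (f 0) (g 0) _ _)
  where
  interchange : ∀ a b p q → a * b * (p * q) ≡ a * p * (b * q)
  interchange = solve-∀

∏-last : ∀ n (f : ℕ → ℤ) → ∏ (suc n) f ≡ ∏ n f * f n
∏-last zero    f = ℤ.*-comm (f 0) 1ℤ
∏-last (suc n) f = trans (cong (f 0 *_) (∏-last n (λ j → f (suc j)))) (sym (ℤ.*-assoc (f 0) _ _))

-- Flipping b (rather than testing j % 2) makes hasParity b (suc j) = hasParity (not b) j
-- hold by definition; hasParity true picks out the odd j.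
hasParity : Bool → ℕ → Bool
hasParity b zero    = not b
hasParity b (suc j) = hasParity (not b) j

parityExp : Bool → ℕ → ℕ → ℕ
parityExp b ℓ j = if hasParity b j then ℓ C j else 0

parityProd : Bool → ℕ → Fn₂
parityProd b ℓ x d = ∏ (suc ℓ) (λ j → (x + + j * d) ^ parityExp b ℓ j)

parityExp-pascal : ∀ b ℓ j → parityExp b (suc ℓ) (suc j) ≡ parityExp (not b) ℓ j ℕ.+ parityExp b ℓ (suc j)
parityExp-pascal b ℓ j with hasParity (not b) j
... | true  = sym (nCk+nC[k+1]≡[n+1]C[k+1] ℓ j)
... | false = refl

parityExp-beyond : ∀ b ℓ → parityExp b ℓ (suc ℓ) ≡ 0
parityExp-beyond b ℓ with hasParity b (suc ℓ)
... | true  = k>n⇒nCk≡0 (ℕ.n<1+n ℓ)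
... | false = refl

parityProd-1-0 : ∀ b ℓ → parityProd b ℓ 1ℤ 0ℤ ≡ 1ℤ
parityProd-1-0 b ℓ = ∏-unit (suc ℓ) λ j →
  trans (cong (λ t → (1ℤ + t) ^ parityExp b ℓ j) (ℤ.*-zeroʳ (+ j))) (ℤ.^-zeroˡ (parityExp b ℓ j))

[x+[1+j]d]≡[x+d]+jd : ∀ x d j → x + + suc j * d ≡ (x + d) + + j * d
[x+[1+j]d]≡[x+d]+jd x d j = trans (cong (λ n → x + n * d) (ℤ.pos-+ 1 j)) (regroup x d (+ j))
  where
  regroup : ∀ x d n → x + (1ℤ + n) * d ≡ (x + d) + n * d
  regroup = solve-∀

parityProd-suc : ∀ b ℓ x d → parityProd b (suc ℓ) x d ≡ parityProd b ℓ x d * parityProd (not b) ℓ (x + d) d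
parityProd-suc b ℓ x d = begin
  a * ∏ (suc ℓ) (λ j → y (suc j) ^ parityExp b (suc ℓ) (suc j))
    ≡⟨ cong (a *_) (∏-cong (suc ℓ) split) ⟩
  a * ∏ (suc ℓ) (λ j → y′ j ^ parityExp (not b) ℓ j * y (suc j) ^ parityExp b ℓ (suc j))
    ≡⟨ cong (a *_) (∏-* (suc ℓ) (λ j → y′ j ^ parityExp (not b) ℓ j) (λ j → y (suc j) ^ parityExp b ℓ (suc j))) ⟩
  a * (P * Q)
    ≡⟨ rotate a P Q ⟩
  a * Q * P
    ≡⟨ cong (_* P) (∏-last (suc ℓ) (λ j → y j ^ parityExp b ℓ j)) ⟩
  parityProd b ℓ x d * y (suc ℓ) ^ parityExp b ℓ (suc ℓ) * P
    ≡⟨ cong (λ e → parityProd b ℓ x d * y (suc ℓ) ^ e * P) (parityExp-beyond b ℓ) ⟩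
  parityProd b ℓ x d * 1ℤ * P
    ≡⟨ cong (_* P) (ℤ.*-identityʳ (parityProd b ℓ x d)) ⟩
  parityProd b ℓ x d * P ∎
  where
  open ≡-Reasoning
  y y′ : ℕ → ℤ
  y j = x + + j * d
  y′ j = (x + d) + + j * d
  a P Q : ℤ
  a = y 0 ^ parityExp b ℓ 0
  P = parityProd (not b) ℓ (x + d) d
  Q = ∏ (suc ℓ) (λ j → y (suc j) ^ parityExp b ℓ (suc j))
  split : ∀ j → y (suc j) ^ parityExp b (suc ℓ) (suc j) ≡ y′ j ^ parityExp (not b) ℓ j * y (suc j) ^ parityExp b ℓ (suc j)
  split j = begin
    y (suc j) ^ parityExp b (suc ℓ) (suc j)
      ≡⟨ cong (y (suc j) ^_) (parityExp-pascal b ℓ j) ⟩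
    y (suc j) ^ (parityExp (not b) ℓ j ℕ.+ parityExp b ℓ (suc j))
      ≡⟨ ℤ.^-distribˡ-+-* (y (suc j)) (parityExp (not b) ℓ j) (parityExp b ℓ (suc j)) ⟩
    y (suc j) ^ parityExp (not b) ℓ j * y (suc j) ^ parityExp b ℓ (suc j)
      ≡⟨ cong (λ z → z ^ parityExp (not b) ℓ j * y (suc j) ^ parityExp b ℓ (suc j)) ([x+[1+j]d]≡[x+d]+jd x d j) ⟩
    y′ j ^ parityExp (not b) ℓ j * y (suc j) ^ parityExp b ℓ (suc j) ∎
  rotate : ∀ a p q → a * (p * q) ≡ a * q * p
  rotate = solve-∀

parityProd-true-1 : ∀ x d → parityProd true 1 x d ≡ x + d
parityProd-true-1 = simplify
  where
  simplify : ∀ x d → 1ℤ * ((x + + 1 * d) * 1ℤ * 1ℤ) ≡ x + d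
  simplify = solve-∀

parityProd-false-1 : ∀ x d → parityProd false 1 x d ≡ x ^ 1
parityProd-false-1 = simplify
  where
  simplify : ∀ x d → (x + + 0 * d) * 1ℤ * (1ℤ * 1ℤ) ≡ x * 1ℤ
  simplify = solve-∀

parityProd-isForm : ∀ b k → IsForm (2 ℕ.^ k) (parityProd b (suc k))
parityProd-isForm true  zero    = isForm-resp parityProd-true-1 isForm-x+d
parityProd-isForm false zero    = isForm-resp parityProd-false-1 (isForm-x^ 1)
parityProd-isForm b     (suc k) =
  isForm-cast (cong (2 ℕ.^ k ℕ.+_) (sym (ℕ.+-identityʳ (2 ℕ.^ k))))
    (isForm-resp (parityProd-suc b (suc k))
      (isForm-* (parityProd-isForm b k) (isForm-shift (parityProd-isForm (not b) k))))

-- The factor functions of oddProd and evenProd are local to Defs; factorsOf recovers them by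
-- unification (the 0-th factor must be supplied, since it reduces).
factorsOf : ∀ ℓ (p₀ : ℤ) {f : ℕ → ℤ} (p : ℤ) → p ≡ p₀ * prodℤ (map f (applyUpTo suc ℓ)) → ℕ → ℤ
factorsOf _ _ {f} _ _ = f

oddFactor evenFactor : ℕ → ℤ → ℤ → ℕ → ℤ
oddFactor  ℓ x d = factorsOf ℓ 1ℤ (oddProd ℓ x d) refl
evenFactor ℓ x d = factorsOf ℓ (factor ℓ 0 x d) (evenProd ℓ x d) refl

hasParity-% : ∀ b j → hasParity b j ≡ (j % 2 ≡ᵇ (if b then 1 else 0))
hasParity-% true  zero          = refl
hasParity-% false zero          = refl
hasParity-% true  (suc zero)    = refl
hasParity-% false (suc zero)    = refl
hasParity-% true  (suc (suc j)) = hasParity-% true j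
hasParity-% false (suc (suc j)) = hasParity-% false j

oddFactor≡ : ∀ ℓ x d j → oddFactor ℓ x d j ≡ (x + + j * d) ^ parityExp true ℓ j
oddFactor≡ ℓ x d j rewrite hasParity-% true j with j % 2
... | 0           = refl
... | 1           = refl
... | suc (suc _) = refl

evenFactor≡ : ∀ ℓ x d j → evenFactor ℓ x d j ≡ (x + + j * d) ^ parityExp false ℓ j
evenFactor≡ ℓ x d j rewrite hasParity-% false j with j % 2
... | 0           = refl
... | 1           = refl
... | suc (suc _) = refl

F≡parityProd : ∀ ℓ x d → F ℓ x d ≡ parityProd true ℓ x d - parityProd false ℓ x d
F≡parityProd ℓ x d = cong₂ _-_
  (trans (prodℤ-map-applyUpTo (suc ℓ) (oddFactor ℓ x d) id) (∏-cong (suc ℓ) (oddFactor≡ ℓ x d)))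
  (trans (prodℤ-map-applyUpTo (suc ℓ) (evenFactor ℓ x d) id) (∏-cong (suc ℓ) (evenFactor≡ ℓ x d)))

parityQuotient : ∀ k → Σ[ m ∈ ℕ ] m ℕ.+ suc k ≡ 2 ℕ.^ k
  × FormQuotient (suc k) m (λ x d → parityProd true (suc k) x d - parityProd false (suc k) x d) (+ (k !))
parityQuotient zero = 0 , refl , record
  { G      = λ _ _ → 1ℤ
  ; G-form = isForm-const 1ℤ
  ; split  = λ x d → trans (cong₂ _-_ (parityProd-true-1 x d) (parityProd-false-1 x d)) (simplify x d)
  ; G-1-0  = refl
  }
  where
  simplify : ∀ x d → (x + d) - x * 1ℤ ≡ d * 1ℤ * 1ℤ
  simplify = solve-∀
parityQuotient (suc k) with parityQuotient k
... | m , degree , Q =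
  m ℕ.+ k ℕ.+ m ,
  trans (doubling m k) (cong (2 ℕ.*_) degree) ,
  FormQuotient-resp
    (λ x d → cong₂ _-_ (parityProd-suc true (suc k) x d) (parityProd-suc false (suc k) x d))
    value
    (cross-difference k m (isForm-cast (sym degree) (parityProd-isForm true k)) Q)
  where
  doubling : ∀ m k → m ℕ.+ k ℕ.+ m ℕ.+ suc (suc k) ≡ 2 ℕ.* (m ℕ.+ suc k)
  doubling = ℕ.solve-∀
  value : + suc k * (parityProd true (suc k) 1ℤ 0ℤ * + (k !)) ≡ + (suc k !)
  value = begin
    + suc k * (parityProd true (suc k) 1ℤ 0ℤ * + (k !)) ≡⟨ cong (λ a → + suc k * (a * + (k !))) (parityProd-1-0 true (suc k)) ⟩
    + suc k * (1ℤ * + (k !))                           ≡⟨ cong (+ suc k *_) (ℤ.*-identityˡ (+ (k !))) ⟩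
    + suc k * + (k !)                                  ≡⟨ sym (ℤ.pos-* (suc k) (k !)) ⟩
    + (suc k !)                                        ∎
    where open ≡-Reasoning

lemma3 : (ℓ : ℕ) → 2 ≤ ℓ →
    Σ (Vec ℤ (suc ((2 ℕ.^ (ℓ ∸ 1)) ∸ ℓ))) λ c →
      ((x d : ℤ) → F ℓ x d ≡ (d ^ ℓ) * evalForm ((2 ℕ.^ (ℓ ∸ 1)) ∸ ℓ) c x d)
      × (evalForm ((2 ℕ.^ (ℓ ∸ 1)) ∸ ℓ) c (+ 1) (+ 0) ≡ + ((ℓ ∸ 1) !))
lemma3 zero    ()
lemma3 (suc k) _ with parityQuotient k
... | m , degree , Q = c ,
  (λ x d → begin
    F (suc k) x d                                              ≡⟨ F≡parityProd (suc k) x d ⟩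
    parityProd true (suc k) x d - parityProd false (suc k) x d ≡⟨ split x d ⟩
    d ^ suc k * G x d                                          ≡⟨ cong (d ^ suc k *_) (G≡ x d) ⟩
    d ^ suc k * evalForm (2 ℕ.^ k ∸ suc k) c x d               ∎) ,
  trans (sym (G≡ 1ℤ 0ℤ)) G-1-0
  where
  open FormQuotient Q
  open ≡-Reasoning
  coefficients : Σ[ c ∈ Vec ℤ (suc (2 ℕ.^ k ∸ suc k)) ] ∀ x d → G x d ≡ evalForm (2 ℕ.^ k ∸ suc k) c x d
  coefficients = isForm⇒evalForm (isForm-cast (trans (sym (ℕ.m+n∸n≡m m (suc k))) (cong (_∸ suc k) degree)) G-form)
  c : Vec ℤ (suc (2 ℕ.^ k ∸ suc k))
  c = proj₁ coefficients
  G≡ : ∀ x d → G x d ≡ evalForm (2 ℕ.^ k ∸ suc k) c x d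
  G≡ = proj₂ coefficients
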